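{- Let $d=1$. Suppose there are $m$ boxes, each of width $1$ and height $\delta_d=2\varepsilon_1^2+\varepsilon_2$, each containing only dense items, such that the total weight $v_1$ of the items in each box is at least $\varepsilon$ and at most $1/2$. Then the items of these boxes can be packed into at most $3+2m/3$ bins such that each resulting bin is $\varepsilon$-slacked. The same holds for boxes of height $1$ and width $\delta_d$.
   Context: Items are $(2,1)$ items: rectangles of width $w(i)$, height $h(i)$ in $[0,1]$ with one nonnegative weight $v_1(i)$; a bin is $[0,1]^2$ with weight capacity $1$, items packed axis-parallel with disjoint interiors. Standing parameters: $\varepsilon^{ -1}\in 2\mathbb Z$, $\varepsilon\le 1/8$; $\varepsilon_1^{ -1},\varepsilon_2^{ -1}\in\mathbb Z$, $\varepsilon_1\le\min(1/5,2\varepsilon/3)$, $\varepsilon_2\le\varepsilon\varepsilon_1^2/2$. An item is dense if $w(i)h(i)=0$ or $v_1(i)/(w(i)h(i))>1/\varepsilon_1^2$. A bin with item set $J$ is $\mu$-slacked if $v_1(J)\le 1-\mu$, or $|J|=1$, or ($|J|=2$, all items of $J$ are dense, and $v_1(i)\le 1/2$ for each $i\in J$). -}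

module Defs where

open import Data.Nat as ℕ using (ℕ; zero; suc; NonZero)
open import Data.Integer using (+_)
open import Data.Rational using (ℚ; 0ℚ; 1ℚ; _+_; _*_; _-_; _≤_; _<_; _/_)
open import Data.Fin using (Fin; zero; suc) renaming (_≟_ to _≟ᶠ_)
open import Data.Product using (_×_; Σ; ∃; ∃-syntax; _,_)
open import Data.Sum using (_⊎_)
open import Data.Bool using (if_then_else_)
open import Relation.Nullary using (¬_; does)
open import Relation.Binary.PropositionalEquality using (_≡_; _≢_)

record Item : Set where
  constructor item
  field
    w : ℚ
    h : ℚ
    v : ℚ
open Item public

ValidItem : Item → Set
ValidItem it = (0ℚ ≤ w it × w it ≤ 1ℚ) × (0ℚ ≤ h it × h it ≤ 1ℚ) × 0ℚ ≤ v it

ℕ→ℚ : ℕ → ℚ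
ℕ→ℚ n = + n / 1

inv : (n : ℕ) → .{{NonZero n}} → ℚ
inv n = + 1 / n

-- Dense w.r.t. ε₁ = 1/E1:  w h = 0  or  v/(w h) > 1/ε₁² (= E1²),
-- written (for w h > 0) as  v > w h · E1².
Dense : (E1 : ℕ) → Item → Set
Dense E1 it = (w it * h it ≡ 0ℚ) ⊎ ((0ℚ < w it * h it) × (w it * h it * ℕ→ℚ (E1 ℕ.* E1) < v it))

sumFin : (n : ℕ) → (Fin n → ℚ) → ℚ
sumFin zero    f = 0ℚ
sumFin (suc n) f = f zero + sumFin n (λ i → f (suc i))

-- Position (x , y) of the lower-left corner of an item.
Pos : Set
Pos = ℚ × ℚ

FitsIn : ℚ → ℚ → Item → Pos → Set
FitsIn W H it (x , y) = (0ℚ ≤ x × x + w it ≤ W) × (0ℚ ≤ y × y + h it ≤ H)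

InInterior : Item → Pos → ℚ → ℚ → Set
InInterior it (x , y) px py = (x < px × px < x + w it) × (y < py × py < y + h it)

DisjointInteriors : Item → Pos → Item → Pos → Set
DisjointInteriors a p b q = ∀ px py → ¬ (InInterior a p px py × InInterior b q px py)

-- N items, each assigned to a container grp i ∈ Fin k and placed at pos i
-- inside its container [0,W]×[0,H]; distinct items in the same container
-- have disjoint interiors (axis-parallel, no rotation).
ValidPlacement : (W H : ℚ) (N k : ℕ) → (Fin N → Item) → (Fin N → Fin k) → (Fin N → Pos) → Set
ValidPlacement W H N k items grp pos =
  (∀ i → FitsIn W H (items i) (pos i)) ×
  (∀ i j → i ≢ j → grp i ≡ grp j → DisjointInteriors (items i) (pos i) (items j) (pos j))

weightOf : (N k : ℕ) → (Fin N → Item) → (Fin N → Fin k) → Fin k → ℚ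
weightOf N k items grp c = sumFin N (λ i → if does (grp i ≟ᶠ c) then v (items i) else 0ℚ)

countOf : (N k : ℕ) → (Fin N → Fin k) → Fin k → ℕ
countOf zero    k grp c = 0
countOf (suc N) k grp c =
  (if does (grp zero ≟ᶠ c) then 1 else 0) ℕ.+ countOf N k (λ i → grp (suc i)) c

Slacked : (E1 : ℕ) (μ : ℚ) (N k : ℕ) → (Fin N → Item) → (Fin N → Fin k) → Fin k → Set
Slacked E1 μ N k items grp c =
  (weightOf N k items grp c ≤ 1ℚ - μ)
  ⊎ (countOf N k grp c ≡ 1)
  ⊎ ((countOf N k grp c ≡ 2) ×
     (∀ i → grp i ≡ c → Dense E1 (items i) × v (items i) ≤ + 1 / 2))

{-# OPTIONS --safe #-}
-- Group the boxes into consecutive triples, padding the last triple with empty boxes, and pack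
-- each triple into two bins; this uses 2(⌊m/3⌋ + 1) ≤ 3 + 2m/3 bins.  Geometrically any split
-- of a triple is fine: in a bin, the items of the r-th box of the triple keep their position in
-- the box shifted by r·δ across the strip, and three strips of width δ ≤ 2/25 + 1/400 fit.
-- For the weights call an item light if v₁ ≤ 1/4.  If some box C of the triple has heavy
-- weight at most 3/8, one bin takes another box A, the heavy items of C and, greedily, light
-- items of C while the weight stays ≤ 7/8; the other bin takes the third box B and the light
-- items of C that are left.  If one is left, the greedy part weighs more than
-- 7/8 − 1/4 − v₁(A) − (heavy weight of C), so the leftover weighs at most v₁(A) − 1/8 ≤ 3/8.
-- Otherwise two boxes have heavy weight > 3/8, hence exactly one heavy item each (two would
-- weigh more than 1/2): these two dense items form one bin, and the rest weighs at most
-- 1/8 + 1/8 + 1/2.  Every bin thus weighs ≤ 7/8 ≤ 1 − ε or holds two dense items of weight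
-- ≤ 1/2.
module Submission where

open import Defs
open import Data.Nat as ℕ using (ℕ; zero; suc; NonZero)
open import Data.Nat.Divisibility using (_∣_)
open import Data.Integer using (+_)
open import Data.Rational using (ℚ; 0ℚ; 1ℚ; _+_; _*_; _-_; -_; _≤_; _<_; _/_; toℚᵘ)
import Data.Rational
import Data.Rational.Unnormalised as ℚᵘ
import Data.Rational.Unnormalised.Properties as ℚᵘ
open import Data.Integer.Solver using () renaming (module +-*-Solver to ℤ-Solver)
import Data.Nat.DivMod as DM
import Data.Rational.Properties as ℚ
open import Data.Rational.Solver using (module +-*-Solver)
open +-*-Solver using (solve; _:+_; _:-_; _:*_; _:=_; con)
open import Data.Fin using (Fin; zero; suc; toℕ; fromℕ<; inject≤; combine; remQuot; quotient; remainder) renaming (_≟_ to _≟ᶠ_)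
open import Data.Fin.Properties using (0≢1+n; toℕ<n; toℕ-injective; toℕ-inject≤; toℕ-fromℕ<; inject≤-injective; combine-remQuot; remQuot-combine; combine-injective)
open import Data.Product using (_×_; Σ; ∃; ∃-syntax; _,_; proj₁; proj₂; swap)
open import Data.Sum using (_⊎_; inj₁; inj₂)
import Data.Sum
open import Data.Bool.Properties using (T-∨; T-∧)
open import Function.Bundles using (Equivalence; mk⇔)
open import Data.Bool using (Bool; true; false; if_then_else_; _∧_; _∨_; not; T)
open import Data.Empty using (⊥-elim)
open import Function using (_∘_)
open import Relation.Binary.PropositionalEquality
open import Relation.Nullary using (Dec; yes; no; does; ¬_)
open import Relation.Nullary.Decidable using (True; toWitness; does-⇔; _×-dec_)
import Data.Nat.Properties as NP
open import Relation.Binary.Definitions using (tri<; tri≈; tri>)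

≤-by-gap : ∀ {x y} d → 0ℚ ≤ d → y ≡ x + d → x ≤ y
≤-by-gap {x} d 0≤d refl = subst (_≤ x + d) (ℚ.+-identityʳ x) (ℚ.+-monoʳ-≤ x 0≤d)

gap-nonneg : ∀ {x y} → x ≤ y → 0ℚ ≤ y - x
gap-nonneg {x} {y} x≤y = subst (_≤ y - x) (ℚ.+-inverseʳ x) (ℚ.+-monoˡ-≤ (- x) x≤y)

gap-pos : ∀ {x y} → x < y → 0ℚ < y - x
gap-pos {x} {y} x<y = subst (_< y - x) (ℚ.+-inverseʳ x) (ℚ.+-monoˡ-< (- x) x<y)

+-nonneg : ∀ {x y} → 0ℚ ≤ x → 0ℚ ≤ y → 0ℚ ≤ x + y
+-nonneg = ℚ.+-mono-≤

≤-decide : (x y : ℚ) → {True (x ℚ.≤? y)} → x ≤ y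
≤-decide x y {x≤y} = toWitness x≤y

½ ¼ ⅛ ⅜ ⅞ : ℚ
½ = + 1 / 2
¼ = + 1 / 4
⅛ = + 1 / 8
⅜ = + 3 / 8
⅞ = + 7 / 8

does-sound : ∀ {a} {A : Set a} (a? : Dec A) → T (does a?) → A
does-sound (yes a) _ = a

does-complete : ∀ {a} {A : Set a} (a? : Dec A) → A → T (does a?)
does-complete (yes _) _ = _
does-complete (no ¬a) a = ¬a a

-- Sums and counts over Boolean predicates

sumFin-cong : ∀ n {f g : Fin n → ℚ} → (∀ i → f i ≡ g i) → sumFin n f ≡ sumFin n g
sumFin-cong zero    f≗g = refl
sumFin-cong (suc n) f≗g = cong₂ _+_ (f≗g zero) (sumFin-cong n (λ i → f≗g (suc i)))

sumFin-mono : ∀ n {f g : Fin n → ℚ} → (∀ i → f i ≤ g i) → sumFin n f ≤ sumFin n g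
sumFin-mono zero    f≤g = ℚ.≤-refl
sumFin-mono (suc n) f≤g = ℚ.+-mono-≤ (f≤g zero) (sumFin-mono n (λ i → f≤g (suc i)))

sumFin-+ : ∀ n (f g : Fin n → ℚ) → sumFin n (λ i → f i + g i) ≡ sumFin n f + sumFin n g
sumFin-+ zero    f g = refl
sumFin-+ (suc n) f g = begin
  (f zero + g zero) + sumFin n (λ i → f (suc i) + g (suc i))
    ≡⟨ cong (_+_ (f zero + g zero)) (sumFin-+ n (λ i → f (suc i)) (λ i → g (suc i))) ⟩
  (f zero + g zero) + (F + G)
    ≡⟨ solve 4 (λ a b c d → (a :+ b) :+ (c :+ d) := (a :+ c) :+ (b :+ d)) refl (f zero) (g zero) F G ⟩
  (f zero + F) + (g zero + G) ∎
  where
  open ≡-Reasoning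
  F = sumFin n (λ i → f (suc i))
  G = sumFin n (λ i → g (suc i))

sumFin-zero : ∀ n → sumFin n (λ _ → 0ℚ) ≡ 0ℚ
sumFin-zero zero    = refl
sumFin-zero (suc n) = cong (_+_ 0ℚ) (sumFin-zero n)

sumFin-nonneg : ∀ n {f : Fin n → ℚ} → (∀ i → 0ℚ ≤ f i) → 0ℚ ≤ sumFin n f
sumFin-nonneg n {f} f≥0 = subst (_≤ sumFin n f) (sumFin-zero n) (sumFin-mono n f≥0)

term≤sumFin : ∀ n {f : Fin n → ℚ} → (∀ i → 0ℚ ≤ f i) → ∀ i → f i ≤ sumFin n f
term≤sumFin (suc n) {f} f≥0 zero    = ≤-by-gap _ (sumFin-nonneg n (λ i → f≥0 (suc i))) refl
term≤sumFin (suc n) {f} f≥0 (suc i) = ℚ.≤-trans (term≤sumFin n (λ j → f≥0 (suc j)) i)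
  (≤-by-gap (f zero) (f≥0 zero) (ℚ.+-comm (f zero) _))

sumIf : (n : ℕ) → (Fin n → Bool) → (Fin n → ℚ) → ℚ
sumIf n p f = sumFin n (λ i → if p i then f i else 0ℚ)

module _ {n : ℕ} {f : Fin n → ℚ} where

  sumIf-cong : ∀ {p q} → (∀ i → p i ≡ q i) → sumIf n p f ≡ sumIf n q f
  sumIf-cong p≗q = sumFin-cong n (λ i → cong (if_then f i else 0ℚ) (p≗q i))

  sumIf-none : ∀ {p} → (∀ i → ¬ T (p i)) → sumIf n p f ≡ 0ℚ
  sumIf-none {p} none = trans (sumFin-cong n pointwise) (sumFin-zero n)
    where
    pointwise : ∀ i → (if p i then f i else 0ℚ) ≡ 0ℚ
    pointwise i with p i | none i
    ... | false | _  = refl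
    ... | true  | ¬⊤ = ⊥-elim (¬⊤ _)

  sumIf-split : (p q : Fin n → Bool) → sumIf n p f ≡ sumIf n (λ i → p i ∧ q i) f + sumIf n (λ i → p i ∧ not (q i)) f
  sumIf-split p q = trans (sumFin-cong n pointwise) (sumFin-+ n _ _)
    where
    pointwise : ∀ i → (if p i then f i else 0ℚ) ≡
      (if p i ∧ q i then f i else 0ℚ) + (if p i ∧ not (q i) then f i else 0ℚ)
    pointwise i with p i | q i
    ... | false | _     = refl
    ... | true  | true  = sym (ℚ.+-identityʳ (f i))
    ... | true  | false = sym (ℚ.+-identityˡ (f i))

  module _ (f≥0 : ∀ i → 0ℚ ≤ f i) where

    if-nonneg : ∀ b i → 0ℚ ≤ (if b then f i else 0ℚ)
    if-nonneg false i = ℚ.≤-refl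
    if-nonneg true  i = f≥0 i

    sumIf-nonneg : ∀ p → 0ℚ ≤ sumIf n p f
    sumIf-nonneg p = sumFin-nonneg n (λ i → if-nonneg (p i) i)

    sumIf-mono : ∀ {p q} → (∀ i → T (p i) → T (q i)) → sumIf n p f ≤ sumIf n q f
    sumIf-mono {p} {q} p⇒q = sumFin-mono n pointwise
      where
      pointwise : ∀ i → (if p i then f i else 0ℚ) ≤ (if q i then f i else 0ℚ)
      pointwise i with p i | q i | p⇒q i
      ... | false | b    | _    = if-nonneg b i
      ... | true  | true | _    = ℚ.≤-refl
      ... | true  | false | imp = ⊥-elim (imp _)

    sumIf-∨ : (p q : Fin n → Bool) → sumIf n (λ i → p i ∨ q i) f ≤ sumIf n p f + sumIf n q f
    sumIf-∨ p q = ℚ.≤-trans (sumFin-mono n pointwise) (ℚ.≤-reflexive (sumFin-+ n _ _))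
      where
      pointwise : ∀ i → (if p i ∨ q i then f i else 0ℚ) ≤ (if p i then f i else 0ℚ) + (if q i then f i else 0ℚ)
      pointwise i with p i | q i
      ... | false | b     = ℚ.≤-reflexive (sym (ℚ.+-identityˡ _))
      ... | true  | false = ℚ.≤-reflexive (sym (ℚ.+-identityʳ (f i)))
      ... | true  | true  = ≤-by-gap (f i) (f≥0 i) refl

    sumIf-cover₂ : ∀ {p} q₁ q₂ → (∀ i → T (p i) → T (q₁ i) ⊎ T (q₂ i)) →
      sumIf n p f ≤ sumIf n q₁ f + sumIf n q₂ f
    sumIf-cover₂ q₁ q₂ cover =
      ℚ.≤-trans (sumIf-mono (λ i pᵢ → Equivalence.from T-∨ (cover i pᵢ))) (sumIf-∨ q₁ q₂)

    sumIf-cover₃ : ∀ {p} q₁ q₂ q₃ → (∀ i → T (p i) → T (q₁ i) ⊎ T (q₂ i) ⊎ T (q₃ i)) →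
      sumIf n p f ≤ sumIf n q₁ f + sumIf n q₂ f + sumIf n q₃ f
    sumIf-cover₃ q₁ q₂ q₃ cover = ℚ.≤-trans
      (sumIf-cover₂ q₁ (λ i → q₂ i ∨ q₃ i) (λ i pᵢ → Data.Sum.map₂ (Equivalence.from T-∨) (cover i pᵢ)))
      (ℚ.≤-trans (ℚ.+-monoʳ-≤ (sumIf n q₁ f) (sumIf-∨ q₂ q₃))
        (ℚ.≤-reflexive (sym (ℚ.+-assoc (sumIf n q₁ f) _ _))))

    term≤sumIf : ∀ p i → T (p i) → f i ≤ sumIf n p f
    term≤sumIf p i pᵢ = subst (_≤ sumIf n p f) (if-true (p i) pᵢ)
      (term≤sumFin n (λ j → if-nonneg (p j) j) i)
      where
      if-true : ∀ b → T b → (if b then f i else 0ℚ) ≡ f i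
      if-true true _ = refl

sumIf-restrict : ∀ n (p g : Fin n → Bool) (f : Fin n → ℚ) →
  sumIf n g (λ i → if p i then f i else 0ℚ) ≡ sumIf n (λ i → p i ∧ g i) f
sumIf-restrict n p g f = sumFin-cong n pointwise
  where
  pointwise : ∀ i → (if g i then (if p i then f i else 0ℚ) else 0ℚ) ≡ (if p i ∧ g i then f i else 0ℚ)
  pointwise i with p i | g i
  ... | true  | _     = refl
  ... | false | true  = refl
  ... | false | false = refl

greedy-fill : ∀ n (f : Fin n → ℚ) {cap s : ℚ} → 0ℚ ≤ cap → (∀ i → 0ℚ ≤ f i) → (∀ i → f i ≤ s) →
  ∃[ g ] (sumIf n g f ≤ cap × ((∀ i → T (g i)) ⊎ cap - s < sumIf n g f))
greedy-fill zero    f cap≥0 f≥0 f≤s = (λ ()) , cap≥0 , inj₁ (λ ())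
greedy-fill (suc n) f {cap} {s} cap≥0 f≥0 f≤s with f zero ℚ.≤? cap
... | yes f₀≤cap = extend true , fits , all-or-full
  where
  IH = greedy-fill n (λ i → f (suc i)) (gap-nonneg f₀≤cap) (λ i → f≥0 (suc i)) (λ i → f≤s (suc i))
  g = proj₁ IH
  rest = sumIf n g (λ i → f (suc i))
  extend : Bool → Fin (suc n) → Bool
  extend b zero    = b
  extend b (suc i) = g i
  fits : f zero + rest ≤ cap
  fits = subst (f zero + rest ≤_) (solve 2 (λ a c → a :+ (c :- a) := c) refl (f zero) cap)
    (ℚ.+-monoʳ-≤ (f zero) (proj₁ (proj₂ IH)))
  all-or-full : (∀ i → T (extend true i)) ⊎ cap - s < f zero + rest
  all-or-full with proj₂ (proj₂ IH)
  ... | inj₁ all  = inj₁ λ { zero → _ ; (suc i) → all i }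
  ... | inj₂ full = inj₂ (subst (_< f zero + rest)
          (solve 3 (λ a c s → a :+ ((c :- a) :- s) := c :- s) refl (f zero) cap s)
          (ℚ.+-monoʳ-< (f zero) full))
... | no f₀≰cap = extend , fits , inj₂ full
  where
  IH = greedy-fill n (λ i → f (suc i)) cap≥0 (λ i → f≥0 (suc i)) (λ i → f≤s (suc i))
  g = proj₁ IH
  rest = sumIf n g (λ i → f (suc i))
  extend : Fin (suc n) → Bool
  extend zero    = false
  extend (suc i) = g i
  fits : 0ℚ + rest ≤ cap
  fits = subst (_≤ cap) (sym (ℚ.+-identityˡ rest)) (proj₁ (proj₂ IH))
  full : cap - s < 0ℚ + rest
  full = ℚ.<-≤-trans (subst (cap - s <_) (ℚ.+-inverseʳ s) (ℚ.+-monoˡ-< (- s) (ℚ.<-≤-trans (ℚ.≰⇒> f₀≰cap) (f≤s zero))))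
    (subst (_≤ 0ℚ + rest) (ℚ.+-identityˡ 0ℚ) (ℚ.+-monoʳ-≤ 0ℚ (sumIf-nonneg (λ i → f≥0 (suc i)) g)))

count : (n : ℕ) → (Fin n → Bool) → ℕ
count zero    p = 0
count (suc n) p = (if p zero then 1 else 0) ℕ.+ count n (λ i → p (suc i))

countOf≡count : ∀ N k (grp : Fin N → Fin k) c → countOf N k grp c ≡ count N (λ i → does (grp i ≟ᶠ c))
countOf≡count zero    k grp c = refl
countOf≡count (suc N) k grp c = cong ((if does (grp zero ≟ᶠ c) then 1 else 0) ℕ.+_) (countOf≡count N k (λ i → grp (suc i)) c)

count-cong : ∀ n {p q : Fin n → Bool} → (∀ i → p i ≡ q i) → count n p ≡ count n q
count-cong zero    p≗q = refl
count-cong (suc n) p≗q = cong₂ ℕ._+_ (cong (if_then 1 else 0) (p≗q zero)) (count-cong n (λ i → p≗q (suc i)))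

count-∨ : ∀ n (p q : Fin n → Bool) → (∀ i → ¬ (T (p i) × T (q i))) →
  count n (λ i → p i ∨ q i) ≡ count n p ℕ.+ count n q
count-∨ zero    p q disjoint = refl
count-∨ (suc n) p q disjoint =
  step (p zero) (q zero) (disjoint zero) (count-∨ n (λ i → p (suc i)) (λ i → q (suc i)) (λ i → disjoint (suc i)))
  where
  step : ∀ a b → ¬ (T a × T b) → ∀ {x y z} → x ≡ y ℕ.+ z →
    (if a ∨ b then 1 else 0) ℕ.+ x ≡ ((if a then 1 else 0) ℕ.+ y) ℕ.+ ((if b then 1 else 0) ℕ.+ z)
  step false false _ refl = refl
  step false true  _ {y = y} refl = sym (NP.+-suc y _)
  step true  false _ refl = refl
  step true  true  both _ = ⊥-elim (both (_ , _))

count-trichotomy : ∀ n (p : Fin n → Bool) {g : Fin n → ℚ} {q : ℚ} → (∀ i → 0ℚ ≤ g i) → (∀ i → T (p i) → q < g i) →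
  (count n p ≡ 0 × sumIf n p g ≡ 0ℚ) ⊎ (count n p ≡ 1 × q < sumIf n p g) ⊎ (q + q < sumIf n p g)
count-trichotomy zero    p g≥0 big = inj₁ (refl , refl)
count-trichotomy (suc n) p {g} {q} g≥0 big with p zero in p₀
  | count-trichotomy n (λ i → p (suc i)) (λ i → g≥0 (suc i)) (λ i → big (suc i))
... | false | inj₁ (c , s)        = inj₁ (c , trans (ℚ.+-identityˡ _) s)
... | false | inj₂ (inj₁ (c , s)) = inj₂ (inj₁ (c , subst (q <_) (sym (ℚ.+-identityˡ _)) s))
... | false | inj₂ (inj₂ s)       = inj₂ (inj₂ (subst (q + q <_) (sym (ℚ.+-identityˡ _)) s))
... | true  | inj₁ (c , s)        = inj₂ (inj₁ (cong suc c ,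
      subst (q <_) (sym (trans (cong (_+_ (g zero)) s) (ℚ.+-identityʳ (g zero)))) (big zero (subst T (sym p₀) _))))
... | true  | inj₂ (inj₁ (c , s)) = inj₂ (inj₂ (ℚ.+-mono-< (big zero (subst T (sym p₀) _)) s))
... | true  | inj₂ (inj₂ s)       = inj₂ (inj₂ (ℚ.<-≤-trans s (≤-by-gap (g zero) (g≥0 zero) (ℚ.+-comm (g zero) _))))

count≡1 : ∀ n (p : Fin n → Bool) {g : Fin n → ℚ} {q : ℚ} → (∀ i → 0ℚ ≤ g i) → (∀ i → T (p i) → q < g i) →
  0ℚ < sumIf n p g → sumIf n p g ≤ q + q → count n p ≡ 1
count≡1 n p g≥0 big pos ≤2q with count-trichotomy n p g≥0 big
... | inj₁ (_ , s≡0)   = ⊥-elim (ℚ.<-irrefl (sym s≡0) pos)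
... | inj₂ (inj₁ (c , _)) = c
... | inj₂ (inj₂ >2q)   = ⊥-elim (ℚ.<-irrefl refl (ℚ.<-≤-trans >2q ≤2q))

⊎-rotate : ∀ {a b c} {A : Set a} {B : Set b} {C : Set c} → A ⊎ B ⊎ C → B ⊎ C ⊎ A
⊎-rotate (inj₁ a)        = inj₂ (inj₂ a)
⊎-rotate (inj₂ (inj₁ b)) = inj₁ b
⊎-rotate (inj₂ (inj₂ c)) = inj₂ (inj₁ c)

⊎-swap₂₃ : ∀ {a b c} {A : Set a} {B : Set b} {C : Set c} → A ⊎ B ⊎ C → A ⊎ C ⊎ B
⊎-swap₂₃ (inj₁ a)        = inj₁ a
⊎-swap₂₃ (inj₂ (inj₁ b)) = inj₂ (inj₂ b)
⊎-swap₂₃ (inj₂ (inj₂ c)) = inj₂ (inj₁ c)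

⊆⇒∧-absorb : ∀ q s → (T s → T q) → q ∧ s ≡ s
⊆⇒∧-absorb true  s     _   = refl
⊆⇒∧-absorb false false _   = refl
⊆⇒∧-absorb false true  s⇒q = ⊥-elim (s⇒q _)

-- Splitting a triple of boxes between two bins

T-∧ˡ : ∀ {a b} → T (a ∧ b) → T a
T-∧ˡ h = proj₁ (Equivalence.to T-∧ h)

T-∧ʳ : ∀ {a b} → T (a ∧ b) → T b
T-∧ʳ h = proj₂ (Equivalence.to T-∧ h)

T-not⇒¬T : ∀ b → T (not b) → ¬ T b
T-not⇒¬T false _ ()

light-split-part-cover : ∀ q a c l t → T (q ∧ (a ∨ c ∧ (not l ∨ t))) → T a ⊎ T (c ∧ not l) ⊎ T ((c ∧ l) ∧ t)
light-split-part-cover true true  _    _     _    _ = inj₁ _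
light-split-part-cover true false true false _    _ = inj₂ (inj₁ _)
light-split-part-cover true false true true  true _ = inj₂ (inj₂ _)

light-split-rest-cover : ∀ q a b c l t → (T q → T a ⊎ T b ⊎ T c) → T (q ∧ not (q ∧ (a ∨ c ∧ (not l ∨ t)))) →
  T b ⊎ T ((c ∧ l) ∧ not t)
light-split-rest-cover true false b c l t within h with within _
... | inj₂ (inj₁ Tb) = inj₁ Tb
... | inj₂ (inj₂ Tc) = inj₂ (in-c c l t Tc h)
  where
  in-c : ∀ c l t → T c → T (not (c ∧ (not l ∨ t))) → T ((c ∧ l) ∧ not t)
  in-c true true false _ _ = _

heavy-split-rest-cover : ∀ q a b c l → (T q → T a ⊎ T b ⊎ T c) → T (q ∧ not (a ∧ not l ∨ b ∧ not l)) →
  T (a ∧ l) ⊎ T (b ∧ l) ⊎ T c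
heavy-split-rest-cover true a b c l within h with within _
... | inj₁ Ta        = inj₁ (in-a a b l Ta h)
  where
  in-a : ∀ a b l → T a → T (not (a ∧ not l ∨ b ∧ not l)) → T (a ∧ l)
  in-a true b true _ _ = _
... | inj₂ (inj₁ Tb) = inj₂ (inj₁ (in-b a b l Tb h))
  where
  in-b : ∀ a b l → T b → T (not (a ∧ not l ∨ b ∧ not l)) → T (b ∧ l)
  in-b a     true true  _ _ = _
  in-b true  true false _ ()
  in-b false true false _ ()
... | inj₂ (inj₂ Tc) = inj₂ (inj₂ Tc)

≤½+≤½ : ∀ {x y} → x ≤ ½ → y ≤ ½ → x + y ≤ 1ℚ
≤½+≤½ x≤½ y≤½ = ℚ.≤-trans (ℚ.+-mono-≤ x≤½ y≤½) (≤-decide (½ + ½) 1ℚ)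

-- The constants enter the ring solver as variables, since normalising rational constants inside
-- it is very slow; the closed last summand of each gap, which evaluates to 0, relates them.
light-part≤⅛ : ∀ {l h} → l + h ≤ ½ → ⅜ < h → l ≤ ⅛
light-part≤⅛ {l} {h} l+h≤½ h>⅜ =
  ≤-by-gap ((½ - (l + h)) + (h - ⅜) + (⅛ - (½ - ⅜)))
    (+-nonneg (+-nonneg (gap-nonneg l+h≤½) (ℚ.<⇒≤ (gap-pos h>⅜))) (≤-decide 0ℚ (⅛ - (½ - ⅜))))
    (solve 5 (λ l h x y z → z := l :+ ((x :- (l :+ h)) :+ (h :- y) :+ (z :- (x :- y)))) refl l h ½ ⅜ ⅛)

room-nonneg : ∀ {a h} → a ≤ ½ → h ≤ ⅜ → 0ℚ ≤ ⅞ - a - h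
room-nonneg {a} {h} a≤½ h≤⅜ =
  ≤-by-gap ((½ - a) + (⅜ - h) + (⅞ - (½ + ⅜)))
    (+-nonneg (+-nonneg (gap-nonneg a≤½) (gap-nonneg h≤⅜)) (≤-decide 0ℚ (⅞ - (½ + ⅜))))
    (solve 5 (λ a h x y z → z :- a :- h := con 0ℚ :+ ((x :- a) :+ (y :- h) :+ (z :- (x :+ y)))) refl a h ½ ⅜ ⅞)

fill-to-room : ∀ {a h t} → t ≤ ⅞ - a - h → a + h + t ≤ ⅞
fill-to-room {a} {h} {t} t≤room = subst (a + h + t ≤_)
  (solve 3 (λ a h z → a :+ h :+ ((z :- a) :- h) := z) refl a h ⅞)
  (ℚ.+-monoʳ-≤ (a + h) t≤room)

leftover-bound : ∀ {a b h p r} → a ≤ ½ → b ≤ ½ → p + r + h ≤ ½ → ⅞ - a - h - ¼ < p → b + r ≤ ⅞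
leftover-bound {a} {b} {h} {p} {r} a≤½ b≤½ prh≤½ p-big =
  ≤-by-gap ((½ - b) + (½ - (p + r + h)) + (p - (⅞ - a - h - ¼)) + (½ - a) + ((⅞ + ⅞) - (½ + ½ + ½ + ¼)))
    (+-nonneg (+-nonneg (+-nonneg (+-nonneg (gap-nonneg b≤½) (gap-nonneg prh≤½)) (ℚ.<⇒≤ (gap-pos p-big))) (gap-nonneg a≤½))
      (≤-decide 0ℚ ((⅞ + ⅞) - (½ + ½ + ½ + ¼))))
    (solve 8 (λ a b h p r x y z → z := b :+ r :+ ((x :- b) :+ (x :- (p :+ r :+ h)) :+ (p :- (z :- a :- h :- y))
                                     :+ (x :- a) :+ ((z :+ z) :- (x :+ x :+ x :+ y)))) refl a b h p r ½ ¼ ⅞)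

two-light-parts-and-a-box : ∀ {x y c} → x ≤ ⅛ → y ≤ ⅛ → c ≤ ½ → x + y + c ≤ ⅞
two-light-parts-and-a-box x≤⅛ y≤⅛ c≤½ = ℚ.≤-trans (ℚ.+-mono-≤ (ℚ.+-mono-≤ x≤⅛ y≤⅛) c≤½) (≤-decide (⅛ + ⅛ + ½) ⅞)

module ThreeBoxes {N M : ℕ} (v : Fin N → ℚ) (box : Fin N → Fin M) (v≥0 : ∀ i → 0ℚ ≤ v i)
  (load≤½ : ∀ b → sumIf N (λ i → does (box i ≟ᶠ b)) v ≤ ½) where

  inBox : Fin M → Fin N → Bool
  inBox b i = does (box i ≟ᶠ b)

  light : Fin N → Bool
  light i = does (v i ℚ.≤? ¼)

  lightIn heavyIn : Fin M → Fin N → Bool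
  lightIn b i = inBox b i ∧ light i
  heavyIn b i = inBox b i ∧ not (light i)

  load lightLoad heavyLoad : Fin M → ℚ
  load b      = sumIf N (inBox b) v
  lightLoad b = sumIf N (lightIn b) v
  heavyLoad b = sumIf N (heavyIn b) v

  load-split : ∀ b → load b ≡ lightLoad b + heavyLoad b
  load-split b = sumIf-split (inBox b) light

  heavyLoad≤½ : ∀ b → heavyLoad b ≤ ½
  heavyLoad≤½ b = ℚ.≤-trans (≤-by-gap (lightLoad b) (sumIf-nonneg v≥0 _)
    (trans (load-split b) (ℚ.+-comm (lightLoad b) (heavyLoad b)))) (load≤½ b)

  lightLoad≤⅛ : ∀ b → ⅜ < heavyLoad b → lightLoad b ≤ ⅛
  lightLoad≤⅛ b heavy = light-part≤⅛ (subst (_≤ ½) (load-split b) (load≤½ b)) heavy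

  heavy-item : ∀ b i → T (heavyIn b i) → ¼ < v i
  heavy-item b i h = ℚ.≰⇒> λ v≤¼ → T-not⇒¬T (light i) (T-∧ʳ h) (does-complete (v i ℚ.≤? ¼) v≤¼)

  light-item : ∀ b i → T (lightIn b i) → v i ≤ ¼
  light-item b i h = does-sound (v i ℚ.≤? ¼) (T-∧ʳ h)

  LightOrPair : (Fin N → Bool) → Set
  LightOrPair P = sumIf N P v ≤ ⅞ ⊎ (count N P ≡ 2 × sumIf N P v ≤ 1ℚ)

  LightOrPair-cong : ∀ {P P′} → (∀ i → P i ≡ P′ i) → LightOrPair P → LightOrPair P′
  LightOrPair-cong P≗P′ (inj₁ light) = inj₁ (subst (_≤ ⅞) (sumIf-cong P≗P′) light)
  LightOrPair-cong P≗P′ (inj₂ (two , w≤1)) =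
    inj₂ (trans (sym (count-cong N P≗P′)) two , subst (_≤ 1ℚ) (sumIf-cong P≗P′) w≤1)

  record TwoBinSplit (Q : Fin N → Bool) : Set where
    field
      part    : Fin N → Bool
      part⊆   : ∀ i → T (part i) → T (Q i)
      part-ok : LightOrPair part
      rest-ok : LightOrPair (λ i → Q i ∧ not (part i))

  Within : (Fin N → Bool) → Fin M → Fin M → Fin M → Set
  Within Q A B C = ∀ i → T (Q i) → T (inBox A i) ⊎ T (inBox B i) ⊎ T (inBox C i)

  split-with-light-box : ∀ {Q} A B C → Within Q A B C → heavyLoad C ≤ ⅜ → TwoBinSplit Q
  split-with-light-box {Q} A B C within heavyC≤⅜ = record
    { part    = part
    ; part⊆   = λ i → T-∧ˡ
    ; part-ok = inj₁ (ℚ.≤-trans (sumIf-cover₃ v≥0 (inBox A) (heavyIn C) lightTaken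
                                   (λ i → light-split-part-cover (Q i) (inBox A i) (inBox C i) (light i) (taken i)))
                                 (fill-to-room {load A} {heavyLoad C} taken-weight))
    ; rest-ok = inj₁ (ℚ.≤-trans (sumIf-cover₂ v≥0 (inBox B) lightLeft
                                   (λ i → light-split-rest-cover (Q i) (inBox A i) (inBox B i) (inBox C i) (light i) (taken i) (within i)))
                                 (leftover-weight (proj₂ (proj₂ greedy))))
    }
    where
    room : ℚ
    room = ⅞ - load A - heavyLoad C

    lightC : Fin N → Bool
    lightC = lightIn C

    lightC-weight : Fin N → ℚ
    lightC-weight i = if lightC i then v i else 0ℚ

    lightC-weight≤¼ : ∀ i → lightC-weight i ≤ ¼
    lightC-weight≤¼ i with lightC i in h
    ... | true  = light-item C i (subst T (sym h) _)
    ... | false = ≤-decide 0ℚ ¼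

    greedy : ∃[ g ] (sumIf N g lightC-weight ≤ room × ((∀ i → T (g i)) ⊎ room - ¼ < sumIf N g lightC-weight))
    greedy = greedy-fill N lightC-weight (room-nonneg (load≤½ A) heavyC≤⅜)
               (λ i → if-nonneg v≥0 (lightC i) i) lightC-weight≤¼

    taken : Fin N → Bool
    taken = proj₁ greedy

    lightTaken lightLeft : Fin N → Bool
    lightTaken i = lightC i ∧ taken i
    lightLeft i  = lightC i ∧ not (taken i)

    part : Fin N → Bool
    part i = Q i ∧ (inBox A i ∨ inBox C i ∧ (not (light i) ∨ taken i))

    taken-weight : sumIf N lightTaken v ≤ room
    taken-weight = subst (_≤ room) (sumIf-restrict N lightC taken v) (proj₁ (proj₂ greedy))

    leftover-weight : (∀ i → T (taken i)) ⊎ room - ¼ < sumIf N taken lightC-weight → load B + sumIf N lightLeft v ≤ ⅞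
    leftover-weight (inj₁ all-taken) =
      subst (_≤ ⅞) (sym (trans (cong (_+_ (load B)) nothing-left) (ℚ.+-identityʳ (load B))))
        (ℚ.≤-trans (load≤½ B) (≤-decide ½ ⅞))
      where
      nothing-left : sumIf N lightLeft v ≡ 0ℚ
      nothing-left = sumIf-none {p = lightLeft} (λ i h → T-not⇒¬T (taken i) (T-∧ʳ {lightC i} h) (all-taken i))
    leftover-weight (inj₂ full) =
      leftover-bound (load≤½ A) (load≤½ B) loadC≤½ (subst (room - ¼ <_) (sumIf-restrict N lightC taken v) full)
      where
      loadC≤½ : sumIf N lightTaken v + sumIf N lightLeft v + heavyLoad C ≤ ½
      loadC≤½ = subst (_≤ ½) (trans (load-split C) (cong (_+ heavyLoad C) (sumIf-split lightC taken))) (load≤½ C)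

  one-heavy-item : ∀ b → ⅜ < heavyLoad b → count N (heavyIn b) ≡ 1
  one-heavy-item b heavy = count≡1 N (heavyIn b) v≥0 (heavy-item b)
    (ℚ.≤-<-trans (≤-decide 0ℚ ⅜) heavy)
    (ℚ.≤-trans (heavyLoad≤½ b) (≤-decide ½ (¼ + ¼)))

  split-with-heavy-boxes : ∀ {Q} A B C → A ≢ B → Within Q A B C →
    (∀ i → T (inBox A i) → T (Q i)) → (∀ i → T (inBox B i) → T (Q i)) →
    ⅜ < heavyLoad A → ⅜ < heavyLoad B → TwoBinSplit Q
  split-with-heavy-boxes {Q} A B C A≢B within A⊆Q B⊆Q heavyA heavyB = record
    { part    = part
    ; part⊆   = λ i h → Data.Sum.[ A⊆Q i ∘ T-∧ˡ , B⊆Q i ∘ T-∧ˡ ] (Equivalence.to T-∨ h)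
    ; part-ok = inj₂ (pair , ℚ.≤-trans (sumIf-∨ v≥0 (heavyIn A) (heavyIn B)) (≤½+≤½ (heavyLoad≤½ A) (heavyLoad≤½ B)))
    ; rest-ok = inj₁ (ℚ.≤-trans
        (sumIf-cover₃ v≥0 (lightIn A) (lightIn B) (inBox C)
          (λ i → heavy-split-rest-cover (Q i) (inBox A i) (inBox B i) (inBox C i) (light i) (within i)))
        (two-light-parts-and-a-box (lightLoad≤⅛ A heavyA) (lightLoad≤⅛ B heavyB) (load≤½ C)))
    }
    where
    part : Fin N → Bool
    part i = heavyIn A i ∨ heavyIn B i

    disjoint : ∀ i → ¬ (T (heavyIn A i) × T (heavyIn B i))
    disjoint i (ha , hb) = A≢B (trans (sym (does-sound (box i ≟ᶠ A) (T-∧ˡ ha))) (does-sound (box i ≟ᶠ B) (T-∧ˡ hb)))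

    pair : count N part ≡ 2
    pair = trans (count-∨ N (heavyIn A) (heavyIn B) disjoint) (cong₂ ℕ._+_ (one-heavy-item A heavyA) (one-heavy-item B heavyB))

module Triples {N K : ℕ} (v : Fin N → ℚ) (box : Fin N → Fin (K ℕ.* 3)) (v≥0 : ∀ i → 0ℚ ≤ v i)
  (load≤½ : ∀ b → sumIf N (λ i → does (box i ≟ᶠ b)) v ≤ ½) where

  open ThreeBoxes v box v≥0 load≤½

  tripleOf : Fin N → Fin K
  tripleOf i = quotient 3 (box i)

  layerOf : Fin N → Fin 3
  layerOf i = remainder {K} 3 (box i)

  box≡combine : ∀ i → box i ≡ combine (tripleOf i) (layerOf i)
  box≡combine i = sym (combine-remQuot {K} 3 (box i))

  inTriple : Fin K → Fin N → Bool
  inTriple t i = does (tripleOf i ≟ᶠ t)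

  within-triple : ∀ t → Within (inTriple t) (combine t zero) (combine t (suc zero)) (combine t (suc (suc zero)))
  within-triple t i h with tripleOf i | layerOf i | box≡combine i | does-sound (tripleOf i ≟ᶠ t) h
  ... | _ | zero           | eq | refl = inj₁ (does-complete (box i ≟ᶠ _) eq)
  ... | _ | suc zero       | eq | refl = inj₂ (inj₁ (does-complete (box i ≟ᶠ _) eq))
  ... | _ | suc (suc zero) | eq | refl = inj₂ (inj₂ (does-complete (box i ≟ᶠ _) eq))

  triple-member : ∀ t l i → T (inBox (combine t l) i) → T (inTriple t i)
  triple-member t l i h = does-complete (tripleOf i ≟ᶠ t)
    (cong proj₁ (trans (cong (remQuot 3) (does-sound (box i ≟ᶠ combine t l) h)) (remQuot-combine t l)))

  triple-split : ∀ t → TwoBinSplit (inTriple t)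
  triple-split t with heavyLoad (combine t zero) ℚ.≤? ⅜ | heavyLoad (combine t (suc zero)) ℚ.≤? ⅜
  ... | yes light₀ | _          = split-with-light-box _ _ _ (λ i h → ⊎-rotate (within-triple t i h)) light₀
  ... | no _       | yes light₁ = split-with-light-box _ _ _ (λ i h → ⊎-swap₂₃ (within-triple t i h)) light₁
  ... | no heavy₀  | no heavy₁  =
    split-with-heavy-boxes _ _ _ (0≢1+n ∘ proj₂ ∘ combine-injective t zero t (suc zero))
      (within-triple t) (triple-member t zero) (triple-member t (suc zero)) (ℚ.≰⇒> heavy₀) (ℚ.≰⇒> heavy₁)

  part : Fin K → Fin N → Bool
  part t = TwoBinSplit.part (triple-split t)

  sideOf : Fin N → Fin 2
  sideOf i = if part (tripleOf i) i then zero else suc zero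

  binOf : Fin N → Fin (K ℕ.* 2)
  binOf i = combine (tripleOf i) (sideOf i)

  same-bin-and-layer⇒same-box : ∀ i j → binOf i ≡ binOf j → layerOf i ≡ layerOf j → box i ≡ box j
  same-bin-and-layer⇒same-box i j same-bin same-layer = begin
    box i                                  ≡⟨ box≡combine i ⟩
    combine (tripleOf i) (layerOf i)       ≡⟨ cong₂ combine same-triple same-layer ⟩
    combine (tripleOf j) (layerOf j)       ≡⟨ box≡combine j ⟨
    box j                                  ∎
    where
    open ≡-Reasoning
    same-triple = proj₁ (combine-injective (tripleOf i) (sideOf i) (tripleOf j) (sideOf j) same-bin)

  in-bin : ∀ t (r : Fin 2) i → does (binOf i ≟ᶠ combine t r) ≡ inTriple t i ∧ does (sideOf i ≟ᶠ r)
  in-bin t r i = does-⇔ (mk⇔ (combine-injective _ _ t r) λ { (refl , refl) → refl })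
    (binOf i ≟ᶠ combine t r) ((tripleOf i ≟ᶠ t) ×-dec (sideOf i ≟ᶠ r))

  inTriple-∧ : ∀ (f : Fin K → Bool) t i → inTriple t i ∧ f (tripleOf i) ≡ inTriple t i ∧ f t
  inTriple-∧ f t i with tripleOf i | tripleOf i ≟ᶠ t
  ... | _ | yes refl = refl
  ... | _ | no _     = refl

  side-zero : ∀ i → does (sideOf i ≟ᶠ zero) ≡ part (tripleOf i) i
  side-zero i with part (tripleOf i) i
  ... | true  = refl
  ... | false = refl

  side-one : ∀ i → does (sideOf i ≟ᶠ suc zero) ≡ not (part (tripleOf i) i)
  side-one i with part (tripleOf i) i
  ... | true  = refl
  ... | false = refl

  combine-LightOrPair : ∀ t (r : Fin 2) → LightOrPair (λ i → does (binOf i ≟ᶠ combine t r))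
  combine-LightOrPair t zero = LightOrPair-cong (λ i → sym (begin
      does (binOf i ≟ᶠ combine t zero)           ≡⟨ in-bin t zero i ⟩
      inTriple t i ∧ does (sideOf i ≟ᶠ zero)     ≡⟨ cong (inTriple t i ∧_) (side-zero i) ⟩
      inTriple t i ∧ part (tripleOf i) i         ≡⟨ inTriple-∧ (λ s → part s i) t i ⟩
      inTriple t i ∧ part t i                    ≡⟨ ⊆⇒∧-absorb _ _ (TwoBinSplit.part⊆ (triple-split t) i) ⟩
      part t i                                   ∎))
    (TwoBinSplit.part-ok (triple-split t))
    where open ≡-Reasoning
  combine-LightOrPair t (suc zero) = LightOrPair-cong (λ i → sym (begin
      does (binOf i ≟ᶠ combine t (suc zero))     ≡⟨ in-bin t (suc zero) i ⟩
      inTriple t i ∧ does (sideOf i ≟ᶠ suc zero) ≡⟨ cong (inTriple t i ∧_) (side-one i) ⟩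
      inTriple t i ∧ not (part (tripleOf i) i)   ≡⟨ inTriple-∧ (λ s → not (part s i)) t i ⟩
      inTriple t i ∧ not (part t i)              ∎))
    (TwoBinSplit.rest-ok (triple-split t))
    where open ≡-Reasoning

  binOf-LightOrPair : ∀ c → LightOrPair (λ i → does (binOf i ≟ᶠ c))
  binOf-LightOrPair c = subst (λ c → LightOrPair (λ i → does (binOf i ≟ᶠ c))) (combine-remQuot {K} 2 c)
    (combine-LightOrPair (quotient 2 c) (remainder {K} 2 c))

-- Stacking strips into unit bins

transpose : Item → Item
transpose it = item (h it) (w it) (v it)

ValidPlacement-transpose : ∀ {W H N k items grp pos} → ValidPlacement W H N k items grp pos →
  ValidPlacement H W N k (λ i → transpose (items i)) grp (λ i → swap (pos i))
ValidPlacement-transpose (fits , disjoint) =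
  (λ i → swap (fits i)) , λ i j i≢j same px py (inᵢ , inⱼ) → disjoint i j i≢j same py px (swap inᵢ , swap inⱼ)

offset : ℚ → ℕ → ℚ
offset δ zero    = 0ℚ
offset δ (suc r) = offset δ r + δ

offset-nonneg : ∀ {δ} → 0ℚ ≤ δ → ∀ r → 0ℚ ≤ offset δ r
offset-nonneg δ≥0 zero    = ℚ.≤-refl
offset-nonneg δ≥0 (suc r) = +-nonneg (offset-nonneg δ≥0 r) δ≥0

offset-mono : ∀ {δ} → 0ℚ ≤ δ → ∀ {r s} → r ℕ.≤ s → offset δ r ≤ offset δ s
offset-mono δ≥0 {zero}  {s}     _           = offset-nonneg δ≥0 s
offset-mono δ≥0 {suc r} {suc s} (ℕ.s≤s r≤s) = ℚ.+-monoˡ-≤ _ (offset-mono δ≥0 r≤s)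

lifted-top : ∀ {y o h δ} → y + h ≤ δ → y + o + h ≤ o + δ
lifted-top {y} {o} {h} {δ} y+h≤δ = subst (_≤ o + δ) (solve 3 (λ y o h → o :+ (y :+ h) := y :+ o :+ h) refl y o h)
  (ℚ.+-monoʳ-≤ o y+h≤δ)

interior-lower : ∀ it x y o px py → InInterior it (x , y + o) px py → InInterior it (x , y) px (py - o)
interior-lower it x y o px py (inˣ , low , high) = inˣ ,
  subst (_< py - o) (solve 2 (λ y o → (y :+ o) :- o := y) refl y o) (ℚ.+-monoˡ-< (- o) low) ,
  subst (py - o <_) (solve 3 (λ y o h → (y :+ o :+ h) :- o := y :+ h) refl y o (h it)) (ℚ.+-monoˡ-< (- o) high)

module Stacking {W δ : ℚ} {N M k L : ℕ} {items : Fin N → Item} {box : Fin N → Fin M} {pos : Fin N → Pos}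
  (δ≥0 : 0ℚ ≤ δ) (L-layers-fit : offset δ L ≤ 1ℚ)
  (bin : Fin N → Fin k) (layer : Fin N → Fin L)
  (separated : ∀ i j → bin i ≡ bin j → layer i ≡ layer j → box i ≡ box j) where

  lift : Fin N → ℚ
  lift i = offset δ (toℕ (layer i))

  stacked : Fin N → Pos
  stacked i = proj₁ (pos i) , proj₂ (pos i) + lift i

  stack-layers : ValidPlacement W δ N M items box pos → ValidPlacement W 1ℚ N k items bin stacked
  stack-layers (fits , disjoint) = fits′ , disjoint′
    where
    top≤next-layer : ∀ i → proj₂ (pos i) + lift i + h (items i) ≤ offset δ (suc (toℕ (layer i)))
    top≤next-layer i = lifted-top {proj₂ (pos i)} {lift i} (proj₂ (proj₂ (fits i)))

    fits′ : ∀ i → FitsIn W 1ℚ (items i) (stacked i)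
    fits′ i = proj₁ (fits i) , +-nonneg (proj₁ (proj₂ (fits i))) (offset-nonneg δ≥0 (toℕ (layer i))) ,
      ℚ.≤-trans (top≤next-layer i) (ℚ.≤-trans (offset-mono δ≥0 (toℕ<n (layer i))) L-layers-fit)

    lower-layer-below : ∀ i j → toℕ (layer i) ℕ.< toℕ (layer j) → ∀ px py →
      ¬ (InInterior (items i) (stacked i) px py × InInterior (items j) (stacked j) px py)
    lower-layer-below i j lᵢ<lⱼ px py ((_ , _ , below-topᵢ) , (_ , above-bottomⱼ , _)) =
      ℚ.<-irrefl refl (ℚ.<-trans below-topᵢ (ℚ.≤-<-trans topᵢ≤bottomⱼ above-bottomⱼ))
      where
      topᵢ≤bottomⱼ : proj₂ (pos i) + lift i + h (items i) ≤ proj₂ (pos j) + lift j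
      topᵢ≤bottomⱼ = ℚ.≤-trans (top≤next-layer i) (ℚ.≤-trans (offset-mono δ≥0 lᵢ<lⱼ)
        (≤-by-gap (proj₂ (pos j)) (proj₁ (proj₂ (fits j))) (ℚ.+-comm (proj₂ (pos j)) (lift j))))

    disjoint′ : ∀ i j → i ≢ j → bin i ≡ bin j → DisjointInteriors (items i) (stacked i) (items j) (stacked j)
    disjoint′ i j i≢j same-bin px py (inᵢ , inⱼ) with NP.<-cmp (toℕ (layer i)) (toℕ (layer j))
    ... | tri< lᵢ<lⱼ _ _ = lower-layer-below i j lᵢ<lⱼ px py (inᵢ , inⱼ)
    ... | tri> _ _ lⱼ<lᵢ = lower-layer-below j i lⱼ<lᵢ px py (inⱼ , inᵢ)
    ... | tri≈ _ same _  = disjoint i j i≢j (separated i j same-bin (toℕ-injective same)) px (py - lift i)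
      (interior-lower (items i) (proj₁ (pos i)) (proj₂ (pos i)) (lift i) px py inᵢ ,
       interior-lower (items j) (proj₁ (pos j)) (proj₂ (pos j)) (lift i) px py
         (subst (λ o → InInterior (items j) (proj₁ (pos j) , proj₂ (pos j) + o) px py)
         (cong (offset δ) (sym same)) inⱼ))

-- Bin count and strip width

ℕ→ℚ-suc : ∀ n → ℕ→ℚ (suc n) ≡ 1ℚ + ℕ→ℚ n
ℕ→ℚ-suc n = trans (ℚ.fromℚᵘ-cong unnormalised) (ℚ.fromℚᵘ-toℚᵘ (1ℚ + ℕ→ℚ n))
  where
  open ℤ-Solver using () renaming (solve to ℤ-solve; _:+_ to _⊕_; _:*_ to _⊗_; _:=_ to _≐_; con to ℤ-con)
  unnormalised : ℚᵘ.mkℚᵘ (+ suc n) 0 ℚᵘ.≃ toℚᵘ (1ℚ + ℕ→ℚ n)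
  unnormalised = ℚᵘ.≃-trans (ℚᵘ.*≡* (ℤ-solve 1 (λ x → (ℤ-con (+ 1) ⊕ x) ⊗ ℤ-con (+ 1)
                                                   ≐ (ℤ-con (+ 1) ⊗ ℤ-con (+ 1) ⊕ x ⊗ ℤ-con (+ 1)) ⊗ ℤ-con (+ 1)) refl (+ n)))
    (ℚᵘ.≃-trans (ℚᵘ.+-congʳ (ℚᵘ.mkℚᵘ (+ 1) 0) (ℚᵘ.≃-sym (ℚ.toℚᵘ-fromℚᵘ (ℚᵘ.mkℚᵘ (+ n) 0))))
                (ℚᵘ.≃-sym (ℚ.toℚᵘ-homo-+ 1ℚ (ℕ→ℚ n))))

triples-bound : ∀ q r → r ℕ.< 3 → ℕ→ℚ (suc q ℕ.* 2) ≤ (+ 3 / 1) + (+ 2 / 3) * ℕ→ℚ (r ℕ.+ q ℕ.* 3)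
triples-bound zero 0 _ = ≤-decide (ℕ→ℚ 2) ((+ 3 / 1) + (+ 2 / 3) * ℕ→ℚ 0)
triples-bound zero 1 _ = ≤-decide (ℕ→ℚ 2) ((+ 3 / 1) + (+ 2 / 3) * ℕ→ℚ 1)
triples-bound zero 2 _ = ≤-decide (ℕ→ℚ 2) ((+ 3 / 1) + (+ 2 / 3) * ℕ→ℚ 2)
triples-bound zero (suc (suc (suc _))) (ℕ.s≤s (ℕ.s≤s (ℕ.s≤s ())))
triples-bound (suc q) r r<3 = subst₂ (λ a b → a ≤ (+ 3 / 1) + (+ 2 / 3) * b) (sym two-more) (sym three-more)
  (≤-by-gap ((+ 3 / 1) + (+ 2 / 3) * R - L) (gap-nonneg (triples-bound q r r<3))
    (solve 2 (λ L R → con (+ 3 / 1) :+ con (+ 2 / 3) :* (con 1ℚ :+ (con 1ℚ :+ (con 1ℚ :+ R)))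
                      := con 1ℚ :+ (con 1ℚ :+ L) :+ ((con (+ 3 / 1) :+ con (+ 2 / 3) :* R) :- L)) refl L R))
  where
  L = ℕ→ℚ (suc q ℕ.* 2)
  R = ℕ→ℚ (r ℕ.+ q ℕ.* 3)
  two-more : ℕ→ℚ (suc (suc q) ℕ.* 2) ≡ 1ℚ + (1ℚ + L)
  two-more = trans (ℕ→ℚ-suc (suc (suc q ℕ.* 2))) (cong (_+_ 1ℚ) (ℕ→ℚ-suc (suc q ℕ.* 2)))
  three-more : ℕ→ℚ (r ℕ.+ suc q ℕ.* 3) ≡ 1ℚ + (1ℚ + (1ℚ + R))
  three-more = begin
    ℕ→ℚ (r ℕ.+ suc q ℕ.* 3)                     ≡⟨ cong ℕ→ℚ (NP.+-suc r (suc (suc (q ℕ.* 3)))) ⟩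
    ℕ→ℚ (suc (r ℕ.+ suc (suc (q ℕ.* 3))))       ≡⟨ cong ℕ→ℚ (cong suc (NP.+-suc r (suc (q ℕ.* 3)))) ⟩
    ℕ→ℚ (suc (suc (r ℕ.+ suc (q ℕ.* 3))))       ≡⟨ cong ℕ→ℚ (cong (λ x → suc (suc x)) (NP.+-suc r (q ℕ.* 3))) ⟩
    ℕ→ℚ (suc (suc (suc (r ℕ.+ q ℕ.* 3))))       ≡⟨ ℕ→ℚ-suc (suc (suc (r ℕ.+ q ℕ.* 3))) ⟩
    1ℚ + ℕ→ℚ (suc (suc (r ℕ.+ q ℕ.* 3)))        ≡⟨ cong (_+_ 1ℚ) (ℕ→ℚ-suc (suc (r ℕ.+ q ℕ.* 3))) ⟩
    1ℚ + (1ℚ + ℕ→ℚ (suc (r ℕ.+ q ℕ.* 3)))       ≡⟨ cong (λ x → 1ℚ + (1ℚ + x)) (ℕ→ℚ-suc (r ℕ.+ q ℕ.* 3)) ⟩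
    1ℚ + (1ℚ + (1ℚ + R))                        ∎
    where open ≡-Reasoning

bins-bound : ∀ m → ℕ→ℚ (suc (m ℕ./ 3) ℕ.* 2) ≤ (+ 3 / 1) + (+ 2 / 3) * ℕ→ℚ m
bins-bound m = subst (λ x → ℕ→ℚ (suc (m ℕ./ 3) ℕ.* 2) ≤ (+ 3 / 1) + (+ 2 / 3) * ℕ→ℚ x)
  (sym (DM.m≡m%n+[m/n]*n m 3)) (triples-bound (m ℕ./ 3) (m ℕ.% 3) (DM.m%n<n m 3))

*-mono-≤-nonneg : ∀ {a b c d} → 0ℚ ≤ a → 0ℚ ≤ c → a ≤ b → c ≤ d → a * c ≤ b * d
*-mono-≤-nonneg {a} {b} {c} {d} a≥0 c≥0 a≤b c≤d =
  ℚ.≤-trans (ℚ.*-monoʳ-≤-nonNeg c {{Data.Rational.nonNegative c≥0}} a≤b)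
            (ℚ.*-monoˡ-≤-nonNeg b {{Data.Rational.nonNegative (ℚ.≤-trans a≥0 a≤b)}} c≤d)

*-nonneg : ∀ {a b} → 0ℚ ≤ a → 0ℚ ≤ b → 0ℚ ≤ a * b
*-nonneg a≥0 b≥0 = *-mono-≤-nonneg ℚ.≤-refl ℚ.≤-refl a≥0 b≥0

inv-nonneg : ∀ n .{{_ : NonZero n}} → 0ℚ ≤ inv n
inv-nonneg n = ℚ.<⇒≤ (ℚ.positive⁻¹ (inv n) {{ℚ.normalize-pos 1 n}})

strip-height-nonneg : ∀ {ε₁ ε₂} → 0ℚ ≤ ε₁ → 0ℚ ≤ ε₂ → 0ℚ ≤ (+ 2 / 1) * ε₁ * ε₁ + ε₂
strip-height-nonneg ε₁≥0 ε₂≥0 = +-nonneg (*-nonneg (*-nonneg (≤-decide 0ℚ (+ 2 / 1)) ε₁≥0) ε₁≥0) ε₂≥0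

three-strips-fit : ∀ {ε ε₁ ε₂} → 0ℚ ≤ ε → 0ℚ ≤ ε₁ → ε ≤ ⅛ → ε₁ ≤ + 1 / 5 → ε₂ ≤ ε * ε₁ * ε₁ * ½ →
  offset ((+ 2 / 1) * ε₁ * ε₁ + ε₂) 3 ≤ 1ℚ
three-strips-fit {ε} {ε₁} {ε₂} ε≥0 ε₁≥0 ε≤⅛ ε₁≤⅕ ε₂≤ = ℚ.≤-trans
  (ℚ.+-mono-≤ (ℚ.+-mono-≤ (ℚ.+-mono-≤ (ℚ.≤-refl {0ℚ}) δ≤D) δ≤D) δ≤D) (≤-decide (0ℚ + D + D + D) 1ℚ)
  where
  D : ℚ
  D = (+ 2 / 1) * (+ 1 / 5) * (+ 1 / 5) + ⅛ * (+ 1 / 5) * (+ 1 / 5) * ½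
  2ε₁≥0 : 0ℚ ≤ (+ 2 / 1) * ε₁
  2ε₁≥0 = *-nonneg (≤-decide 0ℚ (+ 2 / 1)) ε₁≥0
  εε₁≥0 : 0ℚ ≤ ε * ε₁
  εε₁≥0 = *-nonneg ε≥0 ε₁≥0
  δ≤D : (+ 2 / 1) * ε₁ * ε₁ + ε₂ ≤ D
  δ≤D = ℚ.+-mono-≤
    (*-mono-≤-nonneg 2ε₁≥0 ε₁≥0 (*-mono-≤-nonneg (≤-decide 0ℚ (+ 2 / 1)) ε₁≥0 ℚ.≤-refl ε₁≤⅕) ε₁≤⅕)
    (ℚ.≤-trans ε₂≤ (*-mono-≤-nonneg (*-nonneg εε₁≥0 ε₁≥0) (≤-decide 0ℚ ½)
      (*-mono-≤-nonneg εε₁≥0 ε₁≥0 (*-mono-≤-nonneg ε≥0 ε₁≥0 ε≤⅛ ε₁≤⅕) ε₁≤⅕) ℚ.≤-refl))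

⅞≤1-ε : ∀ {ε} → ε ≤ ⅛ → ⅞ ≤ 1ℚ - ε
⅞≤1-ε {ε} ε≤⅛ = ≤-by-gap ((⅛ - ε) + (1ℚ - (⅞ + ⅛)))
  (+-nonneg (gap-nonneg ε≤⅛) (≤-decide 0ℚ (1ℚ - (⅞ + ⅛))))
  (solve 4 (λ e x y o → o :- e := x :+ ((y :- e) :+ (o :- (x :+ y)))) refl ε ⅞ ⅛ 1ℚ)

m<[1+m/3]*3 : ∀ m → m ℕ.< suc (m ℕ./ 3) ℕ.* 3
m<[1+m/3]*3 m = subst (ℕ._< suc (m ℕ./ 3) ℕ.* 3) (sym (DM.m≡m%n+[m/n]*n m 3))
  (NP.+-monoˡ-< (m ℕ./ 3 ℕ.* 3) (DM.m%n<n m 3))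

module Packing {m N : ℕ} (items : Fin N → Item) (box : Fin N → Fin m)
  (v≥0 : ∀ i → 0ℚ ≤ v (items i)) (load≤½ : ∀ b → weightOf N m items box b ≤ ½) where

  K : ℕ
  K = suc (m ℕ./ 3)

  m≤K*3 : m ℕ.≤ K ℕ.* 3
  m≤K*3 = NP.<⇒≤ (m<[1+m/3]*3 m)

  pad : Fin m → Fin (K ℕ.* 3)
  pad b = inject≤ b m≤K*3

  padded-load≤½ : ∀ b → sumIf N (λ i → does (pad (box i) ≟ᶠ b)) (λ i → v (items i)) ≤ ½
  padded-load≤½ b with toℕ b ℕ.<? m
  ... | yes b<m = subst (_≤ ½) (sumIf-cong same-box) (load≤½ (fromℕ< b<m))
    where
    pad-b₀ : pad (fromℕ< b<m) ≡ b
    pad-b₀ = toℕ-injective (trans (toℕ-inject≤ (fromℕ< b<m) _) (toℕ-fromℕ< b<m))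
    same-box : ∀ i → does (box i ≟ᶠ fromℕ< b<m) ≡ does (pad (box i) ≟ᶠ b)
    same-box i = does-⇔ (mk⇔ (λ e → trans (cong pad e) pad-b₀)
                             (λ e → inject≤-injective m≤K*3 m≤K*3 _ _ (trans e (sym pad-b₀))))
                        (box i ≟ᶠ fromℕ< b<m) (pad (box i) ≟ᶠ b)
  ... | no b≮m = ℚ.≤-trans (ℚ.≤-reflexive (sumIf-none nothing-there)) (≤-decide 0ℚ ½)
    where
    nothing-there : ∀ i → ¬ T (does (pad (box i) ≟ᶠ b))
    nothing-there i h = b≮m (subst (ℕ._< m) (trans (sym (toℕ-inject≤ (box i) _)) (cong toℕ (does-sound (pad (box i) ≟ᶠ b) h)))
                                   (toℕ<n (box i)))

  open Triples {N} {K} (λ i → v (items i)) (λ i → pad (box i)) v≥0 padded-load≤½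
    using (binOf; layerOf; same-bin-and-layer⇒same-box; binOf-LightOrPair)
    public

  separated : ∀ i j → binOf i ≡ binOf j → layerOf i ≡ layerOf j → box i ≡ box j
  separated i j same-bin same-layer =
    inject≤-injective m≤K*3 m≤K*3 (box i) (box j) (same-bin-and-layer⇒same-box i j same-bin same-layer)

  item≤½ : ∀ i → v (items i) ≤ ½
  item≤½ i = ℚ.≤-trans (term≤sumIf v≥0 (λ j → does (box j ≟ᶠ box i)) i (does-complete (box i ≟ᶠ box i) refl))
                       (load≤½ (box i))

  packed-slacked : ∀ {E1 ε} → (∀ i → Dense E1 (items i)) → ε ≤ ⅛ →
    ∀ c → weightOf N (K ℕ.* 2) items binOf c ≤ 1ℚ × Slacked E1 ε N (K ℕ.* 2) items binOf c
  packed-slacked dense ε≤⅛ c with binOf-LightOrPair c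
  ... | inj₁ w≤⅞ = ℚ.≤-trans w≤⅞ (≤-decide ⅞ 1ℚ) , inj₁ (ℚ.≤-trans w≤⅞ (⅞≤1-ε ε≤⅛))
  ... | inj₂ (two , w≤1) = w≤1 , inj₂ (inj₂ (trans (countOf≡count N _ binOf c) two , λ i _ → dense i , item≤½ i))

  packed-placement : ∀ {W H δ pos} → 0ℚ ≤ δ → offset δ 3 ≤ 1ℚ → (W ≡ 1ℚ × H ≡ δ) ⊎ (W ≡ δ × H ≡ 1ℚ) →
    ValidPlacement W H N m items box pos → Σ (Fin N → Pos) (ValidPlacement 1ℚ 1ℚ N (K ℕ.* 2) items binOf)
  packed-placement {δ = δ} {pos} δ≥0 fit (inj₁ (refl , refl)) horizontal = _ , stack-layers horizontal
    where open Stacking {1ℚ} {δ} {N} {m} {K ℕ.* 2} {3} {items} {box} {pos} δ≥0 fit binOf layerOf separated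
  packed-placement {δ = δ} {pos} δ≥0 fit (inj₂ (refl , refl)) vertical =
    _ , ValidPlacement-transpose {items = λ i → transpose (items i)} {pos = stacked}
          (stack-layers (ValidPlacement-transpose {δ} {1ℚ} {N} {m} {items} {box} {pos} vertical))
    where open Stacking {1ℚ} {δ} {N} {m} {K ℕ.* 2} {3} {λ i → transpose (items i)} {box} {λ i → swap (pos i)}
                        δ≥0 fit binOf layerOf separated

lemma41 : (E E1 E2 : ℕ) .{{_ : NonZero E}} .{{_ : NonZero E1}} .{{_ : NonZero E2}} →
    2 ∣ E → inv E ≤ + 1 / 8 →
    inv E1 ≤ + 1 / 5 → inv E1 ≤ (+ 2 / 3) * inv E →
    inv E2 ≤ inv E * inv E1 * inv E1 * (+ 1 / 2) →
    (W H : ℚ) →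
    ((W ≡ 1ℚ × H ≡ (+ 2 / 1) * inv E1 * inv E1 + inv E2) ⊎ (W ≡ (+ 2 / 1) * inv E1 * inv E1 + inv E2 × H ≡ 1ℚ)) →
    (m N : ℕ) (items : Fin N → Item) (box : Fin N → Fin m) (posInBox : Fin N → Pos) →
    (∀ i → ValidItem (items i)) →
    (∀ i → Dense E1 (items i)) →
    ValidPlacement W H N m items box posInBox →
    (∀ b → inv E ≤ weightOf N m items box b × weightOf N m items box b ≤ + 1 / 2) →
    ∃[ k ] (ℕ→ℚ k ≤ (+ 3 / 1) + (+ 2 / 3) * ℕ→ℚ m ×
      Σ (Fin N → Fin k) λ bin → Σ (Fin N → Pos) λ pos →
        ValidPlacement 1ℚ 1ℚ N k items bin pos ×
        (∀ c → weightOf N k items bin c ≤ 1ℚ × Slacked E1 (inv E) N k items bin c))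
lemma41 E E1 E2 _ ε≤⅛ ε₁≤⅕ _ ε₂≤ _ _ shape m N items box _ valid dense placement weights =
  K ℕ.* 2 , bins-bound m , binOf , proj₁ packed , proj₂ packed , packed-slacked {E1} dense ε≤⅛
  where
  open Packing items box (λ i → proj₂ (proj₂ (valid i))) (λ b → proj₂ (weights b))

  packed : Σ (Fin N → Pos) (ValidPlacement 1ℚ 1ℚ N (K ℕ.* 2) items binOf)
  packed = packed-placement (strip-height-nonneg (inv-nonneg E1) (inv-nonneg E2))
    (three-strips-fit (inv-nonneg E) (inv-nonneg E1) ε≤⅛ ε₁≤⅕ ε₂≤) shape placement
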